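{- There are infinitely many integer quintuples $(a,b,c,r,s)$ with $a>1$, $b>1$, $c>0$, $r>0$, $s>0$ and $\gcd(ra,sb)=1$ for which the equation $(-1)^u r a^x + (-1)^v s b^y = c$ has exactly three solutions $(x,y,u,v)$ (with $x,y$ nonnegative integers and $u,v\in\{0,1\}$); this remains true even if one considers only sets of solutions in basic form.
   Context: A set of solutions $(a,b,c,r,s;x_1,y_1,\dots,x_N,y_N)$ is the unordered set of $N>2$ distinct pairs $(x_i,y_i)$, each giving a solution for the given $a,b,c,r,s$ (the pair $(x,y)$ determines $(u,v)$). It is in basic form if $\gcd(r,sb)=\gcd(s,ra)=1$, $\min_i x_i=\min_i y_i=0$, and neither $a$ nor $b$ is a perfect power. -}

module Defs where

open import Data.Nat using (ℕ; _*_; _^_; _≥_; _>_; _+_)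
open import Data.Nat.GCD using (gcd)
open import Data.Integer as ℤ using (ℤ; +_)
open import Data.Fin using (Fin; zero; suc)
open import Data.Product using (Σ; ∃; _×_; _,_; proj₁; proj₂)
open import Data.Sum using (_⊎_)
open import Relation.Binary.PropositionalEquality using (_≡_)
open import Relation.Nullary using (¬_)

sgn : Fin 2 → ℤ
sgn zero    = + 1
sgn (suc _) = ℤ.- (+ 1)

Quad : Set
Quad = ℕ × ℕ × Fin 2 × Fin 2

qx qy : Quad → ℕ
qx (x , _ , _ , _) = x
qy (_ , y , _ , _) = y

IsSolution : (a b c r s : ℕ) → Quad → Set
IsSolution a b c r s (x , y , u , v) =
  sgn u ℤ.* (+ (r * a ^ x)) ℤ.+ sgn v ℤ.* (+ (s * b ^ y)) ≡ + c

IsPerfectPower : ℕ → Set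
IsPerfectPower n = Σ ℕ λ m → Σ ℕ λ k → k ≥ 2 × m ^ k ≡ n

SolutionSetIs : (a b c r s : ℕ) → Quad → Quad → Quad → Set
SolutionSetIs a b c r s q₁ q₂ q₃ =
  ¬ q₁ ≡ q₂ × ¬ q₁ ≡ q₃ × ¬ q₂ ≡ q₃ ×
  (∀ q → IsSolution a b c r s q → (q ≡ q₁ ⊎ q ≡ q₂ ⊎ q ≡ q₃)) ×
  IsSolution a b c r s q₁ × IsSolution a b c r s q₂ × IsSolution a b c r s q₃

BasicForm : (a b c r s : ℕ) → Quad → Quad → Quad → Set
BasicForm a b c r s q₁ q₂ q₃ =
  gcd r (s * b) ≡ 1 × gcd s (r * a) ≡ 1 ×
  (qx q₁ ≡ 0 ⊎ qx q₂ ≡ 0 ⊎ qx q₃ ≡ 0) ×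
  (qy q₁ ≡ 0 ⊎ qy q₂ ≡ 0 ⊎ qy q₃ ≡ 0) ×
  ¬ IsPerfectPower a × ¬ IsPerfectPower b

GoodQuintuple : (a b c r s : ℕ) → Set
GoodQuintuple a b c r s =
  a > 1 × b > 1 × c > 0 × r > 0 × s > 0 × gcd (r * a) (s * b) ≡ 1 ×
  Σ Quad λ q₁ → Σ Quad λ q₂ → Σ Quad λ q₃ →
    SolutionSetIs a b c r s q₁ q₂ q₃ × BasicForm a b c r s q₁ q₂ q₃

module Submission where

-- For t ≥ 1 put a = 2t + 1, b = 4t + 3, c = t + 1, r = 1, s = t.  Then
--   1 + t = c,   a − t = c,   a² − t·b = c
-- give three solutions.  Every other sign pattern or exponent with y ≤ 1 is
-- excluded by size.  For y ≥ 2 we use t ≡ 3 (mod 25): then 5 ∣ b, so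
-- 25 ∣ t·b^y, while c ≡ 4 and a ≡ 7 (mod 25), and the powers of 7 modulo 25
-- are 1, 7, 24, 18, never ±4.  If moreover t ≡ 1 (mod 9), then 3 divides a
-- exactly once and 5 divides b exactly once, so neither is a perfect power.

open import Defs
open import Data.Nat
  using (ℕ; zero; suc; _+_; _*_; _^_; _≤_; _<_; _>_; z≤n; s≤s; s≤s⁻¹; z<s; _%_; _/_; _≤?_;
         NonZero; ≢-nonZero; >-nonZero; >-nonZero⁻¹)
open import Data.Nat.Properties
open import Data.Nat.DivMod using (m≡m%n+[m/n]*n; %-distribˡ-+; %-distribˡ-*; %-remove-+ʳ)
open import Data.Nat.Divisibility
  using (_∣_; divides; ∣-refl; ∣1⇒≡1; ∣m∣n⇒∣m+n; ∣m+n∣m⇒∣n; ∣m⇒∣m*n; ∣n⇒∣m*n; *-pres-∣; n∣m⇒m%n≡0)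
open import Data.Nat.GCD using (gcd)
open import Data.Nat.Coprimality using (Coprime; coprime⇒gcd≡1; 1-coprimeTo)
open import Data.Nat.Primality using (Prime; prime?; euclidsLemma; ¬prime[1])
import Data.Nat.Tactic.RingSolver as ℕ-Solver
open import Data.Integer as ℤ using (+_; 0ℤ)
import Data.Integer.Properties as ℤ
import Data.Integer.Tactic.RingSolver as ℤ-Solver
open import Data.Fin using (Fin; zero; suc)
open import Data.List using (_∷_; [])
open import Data.Product using (Σ; _×_; _,_)
open import Data.Sum using (_⊎_; inj₁; inj₂)
open import Data.Empty using (⊥; ⊥-elim)
open import Function.Bundles using (_⇔_; mk⇔; Equivalence)
import Function.Properties.Equivalence as ⇔
open import Relation.Binary.PropositionalEquality
open import Relation.Nullary using (¬_; yes; no; contradiction)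
open import Relation.Nullary.Decidable using (from-yes)

private
  variable
    k m n p r x y : ℕ

Unsigned : Fin 2 → Fin 2 → (P Q c : ℕ) → Set
Unsigned zero    zero    P Q c = P + Q ≡ c
Unsigned zero    (suc _) P Q c = P ≡ c + Q
Unsigned (suc _) zero    P Q c = Q ≡ c + P
Unsigned (suc _) (suc _) P Q c = 0 ≡ c + (P + Q)

+-injective⇔ : ∀ {m n} → (+ m ≡ + n) ⇔ (m ≡ n)
+-injective⇔ = mk⇔ ℤ.+-injective (cong (ℤ.+_))

rewriteˡ⇔ : ∀ {A : Set} {x y z : A} → x ≡ y → (x ≡ z) ⇔ (y ≡ z)
rewriteˡ⇔ x≡y = mk⇔ (trans (sym x≡y)) (trans x≡y)

i-j≡k⇔i≡k+j : ∀ i j k → (i ℤ.- j ≡ k) ⇔ (i ≡ k ℤ.+ j)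
i-j≡k⇔i≡k+j i j k = mk⇔
  (λ e → trans (i≡i-j+j i j) (cong (ℤ._+ j) e))
  (λ e → trans (cong (ℤ._- j) e) (k+j-j≡k k j))
  where
  i≡i-j+j : ∀ i j → i ≡ i ℤ.- j ℤ.+ j
  i≡i-j+j = ℤ-Solver.solve-∀
  k+j-j≡k : ∀ k j → k ℤ.+ j ℤ.- j ≡ k
  k+j-j≡k = ℤ-Solver.solve-∀

signed⇔unsigned : ∀ u v P Q c →
  (sgn u ℤ.* + P ℤ.+ sgn v ℤ.* + Q ≡ + c) ⇔ Unsigned u v P Q c
signed⇔unsigned zero zero P Q c =
  ⇔.trans (rewriteˡ⇔ (cong₂ ℤ._+_ (ℤ.*-identityˡ (+ P)) (ℤ.*-identityˡ (+ Q)))) +-injective⇔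
signed⇔unsigned zero (suc zero) P Q c =
  ⇔.trans (rewriteˡ⇔ (cong₂ ℤ._+_ (ℤ.*-identityˡ (+ P)) (ℤ.-1*i≡-i (+ Q))))
    (⇔.trans (i-j≡k⇔i≡k+j (+ P) (+ Q) (+ c)) +-injective⇔)
signed⇔unsigned (suc zero) zero P Q c =
  ⇔.trans (rewriteˡ⇔ (trans (cong₂ ℤ._+_ (ℤ.-1*i≡-i (+ P)) (ℤ.*-identityˡ (+ Q))) (ℤ.+-comm (ℤ.- + P) (+ Q))))
    (⇔.trans (i-j≡k⇔i≡k+j (+ Q) (+ P) (+ c)) +-injective⇔)
signed⇔unsigned (suc zero) (suc zero) P Q c =
  ⇔.trans (rewriteˡ⇔ (trans (cong₂ ℤ._+_ (ℤ.-1*i≡-i (+ P)) (ℤ.-1*i≡-i (+ Q))) (negated-sum (+ P) (+ Q))))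
    (⇔.trans (i-j≡k⇔i≡k+j 0ℤ (+ (P + Q)) (+ c)) +-injective⇔)
  where
  negated-sum : ∀ i j → ℤ.- i ℤ.+ ℤ.- j ≡ 0ℤ ℤ.- (i ℤ.+ j)
  negated-sum = ℤ-Solver.solve-∀

^-cancelʳ-≤ : ∀ a → 1 < a → a ^ x ≤ a ^ y → x ≤ y
^-cancelʳ-≤ {x} {y} a 1<a aˣ≤aʸ with x ≤? y
... | yes x≤y = x≤y
... | no x≰y = contradiction aˣ≤aʸ (<⇒≱ (^-monoʳ-< a 1<a (≰⇒> x≰y)))

^-cancelʳ-< : ∀ a → 1 < a → a ^ x < a ^ y → x < y
^-cancelʳ-< {x} {y} a 1<a aˣ<aʸ with x <? y
... | yes x<y = x<y
... | no x≮y = contradiction (^-monoʳ-≤ a {{>-nonZero (<-trans z<s 1<a)}} (≮⇒≥ x≮y)) (<⇒≱ aˣ<aʸ)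

^-injectiveʳ : ∀ a → 1 < a → a ^ x ≡ a ^ y → x ≡ y
^-injectiveʳ a 1<a aˣ≡aʸ =
  ≤-antisym (^-cancelʳ-≤ a 1<a (≤-reflexive aˣ≡aʸ)) (^-cancelʳ-≤ a 1<a (≤-reflexive (sym aˣ≡aʸ)))

^-notBetween : ∀ a → 1 < a → a ^ k < a ^ x → a ^ x < a ^ suc k → ⊥
^-notBetween {k} {x} a 1<a aᵏ<aˣ aˣ<aᵏ⁺¹ =
  <⇒≱ (^-cancelʳ-< {k} {x} a 1<a aᵏ<aˣ) (s≤s⁻¹ (^-cancelʳ-< {x} {suc k} a 1<a aˣ<aᵏ⁺¹))

%-cong-+ˡ : ∀ u m r n .{{_ : NonZero n}} → m % n ≡ r % n → (u + m) % n ≡ (u + r) % n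
%-cong-+ˡ u m r n m≡r = begin
  (u + m) % n             ≡⟨ %-distribˡ-+ u m n ⟩
  (u % n + m % n) % n     ≡⟨ cong (λ z → (u % n + z) % n) m≡r ⟩
  (u % n + r % n) % n     ≡⟨ %-distribˡ-+ u r n ⟨
  (u + r) % n             ∎
  where open ≡-Reasoning

%-cong-*ˡ : ∀ v m r n .{{_ : NonZero n}} → m % n ≡ r % n → (v * m) % n ≡ (v * r) % n
%-cong-*ˡ v m r n m≡r = begin
  (v * m) % n             ≡⟨ %-distribˡ-* v m n ⟩
  (v % n * (m % n)) % n   ≡⟨ cong (λ z → (v % n * z) % n) m≡r ⟩
  (v % n * (r % n)) % n   ≡⟨ %-distribˡ-* v r n ⟨
  (v * r) % n             ∎
  where open ≡-Reasoning

%-cong-affine : ∀ u v m r n .{{_ : NonZero n}} →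
  m % n ≡ r % n → (u + v * m) % n ≡ (u + v * r) % n
%-cong-affine u v m r n m≡r = %-cong-+ˡ u (v * m) (v * r) n (%-cong-*ˡ v m r n m≡r)

∣-by-% : ∀ {d} m n .{{_ : NonZero n}} → d ∣ n → d ∣ m % n → d ∣ m
∣-by-% m n d∣n d∣m%n =
  subst (_ ∣_) (sym (m≡m%n+[m/n]*n m n)) (∣m∣n⇒∣m+n d∣m%n (∣n⇒∣m*n (m / n) d∣n))

PowerOf7Mod25 : ℕ → Set
PowerOf7Mod25 r = r ≡ 1 ⊎ r ≡ 7 ⊎ r ≡ 24 ⊎ r ≡ 18

powerOf7Mod25 : ∀ {a} → a % 25 ≡ 7 → ∀ x → PowerOf7Mod25 (a ^ x % 25)
powerOf7Mod25 a%25≡7 zero = inj₁ refl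
powerOf7Mod25 {a} a%25≡7 (suc x) =
  subst PowerOf7Mod25 (sym (trans (%-distribˡ-* a (a ^ x) 25) (cong (λ z → (z * (a ^ x % 25)) % 25) a%25≡7)))
    (times7 (powerOf7Mod25 a%25≡7 x))
  where
  times7 : PowerOf7Mod25 r → PowerOf7Mod25 ((7 * r) % 25)
  times7 (inj₁ refl)               = inj₂ (inj₁ refl)
  times7 (inj₂ (inj₁ refl))        = inj₂ (inj₂ (inj₁ refl))
  times7 (inj₂ (inj₂ (inj₁ refl))) = inj₂ (inj₂ (inj₂ refl))
  times7 (inj₂ (inj₂ (inj₂ refl))) = inj₁ refl

powerOf7Mod25≢4 : PowerOf7Mod25 r → r ≢ 4
powerOf7Mod25≢4 (inj₁ refl) ()
powerOf7Mod25≢4 (inj₂ (inj₁ refl)) ()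
powerOf7Mod25≢4 (inj₂ (inj₂ (inj₁ refl))) ()
powerOf7Mod25≢4 (inj₂ (inj₂ (inj₂ refl))) ()

4+powerOf7Mod25≢0 : PowerOf7Mod25 r → (4 + r) % 25 ≢ 0
4+powerOf7Mod25≢0 (inj₁ refl) ()
4+powerOf7Mod25≢0 (inj₂ (inj₁ refl)) ()
4+powerOf7Mod25≢0 (inj₂ (inj₂ (inj₁ refl))) ()
4+powerOf7Mod25≢0 (inj₂ (inj₂ (inj₂ refl))) ()

p∣m^n⇒p∣m : Prime p → p ∣ m ^ n → p ∣ m
p∣m^n⇒p∣m {p} {m} {zero} p-prime p∣1 = contradiction (subst Prime (∣1⇒≡1 p∣1) p-prime) ¬prime[1]
p∣m^n⇒p∣m {p} {m} {suc n} p-prime p∣mᵐ⁺¹ with euclidsLemma m (m ^ n) p-prime p∣mᵐ⁺¹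
... | inj₁ p∣m  = p∣m
... | inj₂ p∣mⁿ = p∣m^n⇒p∣m {n = n} p-prime p∣mⁿ

p∣n∧p*p∤n⇒¬perfectPower : Prime p → p ∣ n → ¬ p * p ∣ n → ¬ IsPerfectPower n
p∣n∧p*p∤n⇒¬perfectPower {p} p-prime p∣n p*p∤n (m , suc (suc k) , _ , mᵏ⁺²≡n) =
  p*p∤n (subst (_ ∣_) mᵏ⁺²≡n (*-pres-∣ p∣m (∣m⇒∣m*n (m ^ k) p∣m)))
  where
  p∣m : p ∣ m
  p∣m = p∣m^n⇒p∣m {n = 2 + k} p-prime (subst (_ ∣_) (sym mᵏ⁺²≡n) p∣n)
p∣n∧p*p∤n⇒¬perfectPower _ _ _ (_ , 1 , s≤s () , _)

residue⇒¬perfectPower : Prime p → .{{_ : NonZero (p * p)}} →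
  n % (p * p) ≡ r → p ∣ r → r ≢ 0 → ¬ IsPerfectPower n
residue⇒¬perfectPower {p} {n} p-prime n%p²≡r p∣r r≢0 =
  p∣n∧p*p∤n⇒¬perfectPower p-prime
    (∣-by-% n (p * p) (∣n⇒∣m*n p ∣-refl) (subst (_ ∣_) (sym n%p²≡r) p∣r))
    (λ p²∣n → r≢0 (trans (sym n%p²≡r) (n∣m⇒m%n≡0 n (p * p) p²∣n)))

module Family (t : ℕ) where

  a b c : ℕ
  a = 1 + 2 * t
  b = 3 + 4 * t
  c = 1 + t

  q₁ q₂ q₃ : Quad
  q₁ = 0 , 0 , zero , zero
  q₂ = 1 , 0 , zero , suc zero
  q₃ = 2 , 1 , zero , suc zero

  -- The identities below spell out a, b, c and the powers: the ring solver
  -- does not unfold local definitions.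
  a⁰+t*b⁰≡c : 1 + t * 1 ≡ 1 + t
  a⁰+t*b⁰≡c = ℕ-Solver.solve (t ∷ [])

  a¹≡c+t*b⁰ : (1 + 2 * t) * 1 ≡ (1 + t) + t * 1
  a¹≡c+t*b⁰ = ℕ-Solver.solve (t ∷ [])

  a²≡c+t*b¹ : (1 + 2 * t) * ((1 + 2 * t) * 1) ≡ (1 + t) + t * ((3 + 4 * t) * 1)
  a²≡c+t*b¹ = ℕ-Solver.solve (t ∷ [])

  solution₁ : IsSolution a b c 1 t q₁
  solution₁ = Equivalence.from (signed⇔unsigned zero zero (1 * a ^ 0) (t * b ^ 0) c) a⁰+t*b⁰≡c

  solution₂ : IsSolution a b c 1 t q₂
  solution₂ = Equivalence.from (signed⇔unsigned zero (suc zero) (1 * a ^ 1) (t * b ^ 0) c)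
    (trans (*-identityˡ (a ^ 1)) a¹≡c+t*b⁰)

  solution₃ : IsSolution a b c 1 t q₃
  solution₃ = Equivalence.from (signed⇔unsigned zero (suc zero) (1 * a ^ 2) (t * b ^ 1) c)
    (trans (*-identityˡ (a ^ 2)) a²≡c+t*b¹)

  a⊥t*b : Coprime a (t * b)
  a⊥t*b {d} (d∣a , d∣t*b) =
    ∣1⇒≡1 (∣m+n∣m⇒∣n (subst (d ∣_) a*[1+4t]≡2*t*b+1 (∣m⇒∣m*n (1 + 4 * t) d∣a)) (∣n⇒∣m*n 2 d∣t*b))
    where
    a*[1+4t]≡2*t*b+1 : (1 + 2 * t) * (1 + 4 * t) ≡ 2 * (t * (3 + 4 * t)) + 1
    a*[1+4t]≡2*t*b+1 = ℕ-Solver.solve (t ∷ [])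

  t⊥a : Coprime t a
  t⊥a {d} (d∣t , d∣a) = ∣1⇒≡1 (∣m+n∣m⇒∣n (subst (d ∣_) (+-comm 1 (2 * t)) d∣a) (∣n⇒∣m*n 2 d∣t))

  ¬perfectPower-a : t % 9 ≡ 1 → ¬ IsPerfectPower a
  ¬perfectPower-a t%9≡1 =
    residue⇒¬perfectPower (from-yes (prime? 3)) (%-cong-affine 1 2 t 1 9 t%9≡1) (divides 1 refl) λ ()

  module _ (t%25≡3 : t % 25 ≡ 3) where

    instance
      t≢0 : NonZero t
      t≢0 = ≢-nonZero (λ t≡0 → contradiction (trans (cong (_% 25) (sym t≡0)) t%25≡3) (λ ()))

    1<a : 1 < a
    1<a = s≤s (≤-trans (>-nonZero⁻¹ t) (m≤n*m t 2))

    1<b : 1 < b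
    1<b = s≤s (s≤s z≤n)

    a%25≡7 : a % 25 ≡ 7
    a%25≡7 = %-cong-affine 1 2 t 3 25 t%25≡3

    b%25≡15 : b % 25 ≡ 15
    b%25≡15 = %-cong-affine 3 4 t 3 25 t%25≡3

    c%25≡4 : c % 25 ≡ 4
    c%25≡4 = %-cong-+ˡ 1 t 3 25 t%25≡3

    25∣t*b^[2+y] : ∀ y → 25 ∣ t * b ^ (2 + y)
    25∣t*b^[2+y] y = ∣n⇒∣m*n t (*-pres-∣ 5∣b (∣m⇒∣m*n (b ^ y) 5∣b))
      where
      5∣b : 5 ∣ b
      5∣b = ∣-by-% b 25 (divides 5 refl) (subst (5 ∣_) (sym b%25≡15) (divides 3 refl))

    ¬perfectPower-b : ¬ IsPerfectPower b
    ¬perfectPower-b = residue⇒¬perfectPower (from-yes (prime? 5)) b%25≡15 (divides 3 refl) (λ ())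

    ⁺⁺-solution : ∀ x y → a ^ x + t * b ^ y ≡ c → x ≡ 0 × y ≡ 0
    ⁺⁺-solution x zero e = ^-injectiveʳ {x} {0} a 1<a (+-cancelʳ-≡ t _ _ aˣ+t≡1+t) , refl
      where
      aˣ+t≡1+t : a ^ x + t ≡ 1 + t
      aˣ+t≡1+t = trans (cong (λ z → a ^ x + z) (sym (*-identityʳ t))) e
    ⁺⁺-solution x (suc y) e = contradiction (^-cancelʳ-≤ {suc y} {0} b 1<b (*-cancelˡ-≤ t t*bʸ⁺¹≤t*1)) λ ()
      where
      t*bʸ⁺¹≤t*1 : t * b ^ suc y ≤ t * 1
      t*bʸ⁺¹≤t*1 = subst (t * b ^ suc y ≤_) (sym (*-identityʳ t))
        (s≤s⁻¹ (subst (1 + t * b ^ suc y ≤_) e (+-monoˡ-≤ (t * b ^ suc y) (m^n>0 a x))))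

    ⁺⁻-solution : ∀ x y → a ^ x ≡ c + t * b ^ y → (x ≡ 1 × y ≡ 0) ⊎ (x ≡ 2 × y ≡ 1)
    ⁺⁻-solution x 0 e = inj₁ (^-injectiveʳ {x} {1} a 1<a (trans e (sym a¹≡c+t*b⁰)) , refl)
    ⁺⁻-solution x 1 e = inj₂ (^-injectiveʳ {x} {2} a 1<a (trans e (sym a²≡c+t*b¹)) , refl)
    ⁺⁻-solution x (suc (suc y)) e = ⊥-elim (powerOf7Mod25≢4 (powerOf7Mod25 a%25≡7 x) aˣ%25≡4)
      where
      aˣ%25≡4 : a ^ x % 25 ≡ 4
      aˣ%25≡4 = begin
        a ^ x % 25                    ≡⟨ cong (_% 25) e ⟩
        (c + t * b ^ (2 + y)) % 25    ≡⟨ %-remove-+ʳ c (25∣t*b^[2+y] y) ⟩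
        c % 25                        ≡⟨ c%25≡4 ⟩
        4                             ∎
        where open ≡-Reasoning

    c+a¹<t*b¹ : c + a ^ 1 < t * b ^ 1
    c+a¹<t*b¹ = +-cancelˡ-< 2 _ _ (begin-strict
      2 + (c + a ^ 1)             ≡⟨ +-comm 2 (c + a ^ 1) ⟩
      (c + a ^ 1) + 2             <⟨ +-monoʳ-< (c + a ^ 1) 2<4*t*t ⟩
      (c + a ^ 1) + 4 * (t * t)   ≡⟨ 2+t*b¹≡c+a¹+4*t*t ⟨
      2 + t * b ^ 1               ∎)
      where
      open ≤-Reasoning
      2<4*t*t : 2 < 4 * (t * t)
      2<4*t*t = ≤-trans (s≤s (s≤s (s≤s z≤n))) (*-monoʳ-≤ 4 (*-mono-≤ (>-nonZero⁻¹ t) (>-nonZero⁻¹ t)))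
      2+t*b¹≡c+a¹+4*t*t : 2 + t * ((3 + 4 * t) * 1) ≡ ((1 + t) + (1 + 2 * t) * 1) + 4 * (t * t)
      2+t*b¹≡c+a¹+4*t*t = ℕ-Solver.solve (t ∷ [])

    t*b¹<c+a² : t * b ^ 1 < c + a ^ 2
    t*b¹<c+a² = subst (t * b ^ 1 <_) (sym c+a²≡t*b¹+2+2t) (m<m+n (t * b ^ 1) z<s)
      where
      c+a²≡t*b¹+2+2t : (1 + t) + (1 + 2 * t) * ((1 + 2 * t) * 1) ≡ t * ((3 + 4 * t) * 1) + (2 + 2 * t)
      c+a²≡t*b¹+2+2t = ℕ-Solver.solve (t ∷ [])

    ⁻⁺-impossible : ∀ x y → t * b ^ y ≡ c + a ^ x → ⊥
    ⁻⁺-impossible x 0 e = m≢1+m+n t (trans (sym (*-identityʳ t)) e)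
    ⁻⁺-impossible x 1 e =
      ^-notBetween {1} {x} a 1<a
        (+-cancelˡ-< c _ _ (subst (c + a ^ 1 <_) e c+a¹<t*b¹))
        (+-cancelˡ-< c _ _ (subst (_< c + a ^ 2) e t*b¹<c+a²))
    ⁻⁺-impossible x (suc (suc y)) e = 4+powerOf7Mod25≢0 (powerOf7Mod25 a%25≡7 x) 4+aˣ%25≡0
      where
      4+aˣ%25≡0 : (4 + a ^ x % 25) % 25 ≡ 0
      4+aˣ%25≡0 = begin
        (4 + a ^ x % 25) % 25         ≡⟨ cong (λ z → (z + a ^ x % 25) % 25) c%25≡4 ⟨
        (c % 25 + a ^ x % 25) % 25    ≡⟨ %-distribˡ-+ c (a ^ x) 25 ⟨
        (c + a ^ x) % 25              ≡⟨ cong (_% 25) e ⟨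
        t * b ^ (2 + y) % 25          ≡⟨ n∣m⇒m%n≡0 _ 25 (25∣t*b^[2+y] y) ⟩
        0                             ∎
        where open ≡-Reasoning

    unsigned-solutions : ∀ x y u v → Unsigned u v (a ^ x) (t * b ^ y) c →
      (x , y , u , v) ≡ q₁ ⊎ (x , y , u , v) ≡ q₂ ⊎ (x , y , u , v) ≡ q₃
    unsigned-solutions x y zero zero e with ⁺⁺-solution x y e
    ... | refl , refl = inj₁ refl
    unsigned-solutions x y zero (suc zero) e with ⁺⁻-solution x y e
    ... | inj₁ (refl , refl) = inj₂ (inj₁ refl)
    ... | inj₂ (refl , refl) = inj₂ (inj₂ refl)
    unsigned-solutions x y (suc zero) zero e = ⊥-elim (⁻⁺-impossible x y e)
    unsigned-solutions x y (suc zero) (suc zero) ()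

    solutions-complete : ∀ q → IsSolution a b c 1 t q → q ≡ q₁ ⊎ q ≡ q₂ ⊎ q ≡ q₃
    solutions-complete (x , y , u , v) sol = unsigned-solutions x y u v
      (subst (λ P → Unsigned u v P (t * b ^ y) c) (*-identityˡ (a ^ x))
        (Equivalence.to (signed⇔unsigned u v _ _ c) sol))

    goodQuintuple : t % 9 ≡ 1 → GoodQuintuple a b c 1 t
    goodQuintuple t%9≡1 =
      1<a , 1<b , z<s , z<s , >-nonZero⁻¹ t ,
      trans (cong (λ n → gcd n (t * b)) (*-identityˡ a)) (coprime⇒gcd≡1 a⊥t*b) ,
      q₁ , q₂ , q₃ ,
      ((λ ()) , (λ ()) , (λ ()) , solutions-complete , solution₁ , solution₂ , solution₃) ,
      ( coprime⇒gcd≡1 (1-coprimeTo (t * b))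
      , trans (cong (gcd t) (*-identityˡ a)) (coprime⇒gcd≡1 t⊥a)
      , inj₁ refl , inj₁ refl , ¬perfectPower-a t%9≡1 , ¬perfectPower-b )

theorem3 : (N : ℕ) → Σ ℕ λ a → Σ ℕ λ b → Σ ℕ λ c → Σ ℕ λ r → Σ ℕ λ s →
    a + b + c + r + s > N × GoodQuintuple a b c r s
theorem3 N = a , b , c , 1 , t , <-≤-trans N<t (m≤n+m t (a + b + c + 1)) , goodQuintuple t%25≡3 t%9≡1
  where
  t : ℕ
  t = 28 + 225 * N
  open Family t
  N<t : N < t
  N<t = s≤s (≤-trans (m≤n*m N 225) (m≤n+m (225 * N) 27))
  t%25≡3 : t % 25 ≡ 3
  t%25≡3 = %-remove-+ʳ 28 {d = 25} (∣m⇒∣m*n N (divides 9 refl))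
  t%9≡1 : t % 9 ≡ 1
  t%9≡1 = %-remove-+ʳ 28 {d = 9} (∣m⇒∣m*n N (divides 25 refl))
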